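{- Let $U=\{1,\dots,m\}$, let $f:\mathcal{P}(U)\rightarrow\mathbb{Z}_{\geq 0}$ be a polymatroid function with $n=f(U)\geq 1$, and fix a run of the greedy algorithm on $(U,f)$ with chosen elements $i_1,\dots,i_l$, sets $W_r$, increments $\Delta_r$ and coefficients $a_r^j$ as defined in the context. Suppose $\alpha>0$ is such that there exist a cover $(X_j)_{j\in U}$ of $f$ of minimum entropy and integers $Z_r^j$ ($1\le r\le l$, $j\in U$) with $0\leq Z_r^j\leq a_r^j$, $\sum_{r=1}^l Z_r^j=X_j$ for all $j\in U$, and $\sum_{j=1}^m Z_r^j\leq \alpha\,\Delta_r$ for all $1\leq r\leq l$. Then $\alpha\geq 1$. In particular the covering coefficient $\alpha_G$ satisfies $\alpha_G\geq 1$.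
   Context: A polymatroid function is $f:\mathcal{P}(U)\to\mathbb{Z}_{\ge0}$ that is monotone ($f(S)\le f(T)$ for $S\subseteq T$), submodular, and has $f(\emptyset)=0$. A cover of $f$ is a modular function $g:\mathcal{P}(U)\rightarrow\mathbb{Z}_{\geq 0}$ with $g(U)=f(U)$ and $0\leq g(S)\leq f(S)$ for all $S\subseteq U$; it is identified with the vector $(g(\{j\}))_{j\in U}$. Its entropy is $Ent(g)=-\sum_{j\in U}\frac{g(\{j\})}{n}\log_2\frac{g(\{j\})}{n}$ (with $0\log_2 0=0$). Greedy algorithm: start with $S=\emptyset$; while $f(S)<f(U)$, choose $i\in U\setminus S$ maximizing $f(S\cup\{i\})-f(S)$ (ties broken arbitrarily), set $w_i=f(S\cup\{i\})-f(S)$, and $S:=S\cup\{i\}$; all other $w_i$ are $0$. The chosen elements in order are $i_1,\dots,i_l$; $W_r=\{i_1,\dots,i_r\}$, $W_0=\emptyset$; $\Delta_r=f(W_r)-f(W_{r-1})=w_{i_r}$. For $1\le r\le l$, $j\in U$: $a_r^j=f(W_r)-f(W_{r-1})-\big(f(W_r\cup\{j\})-f(W_{r-1}\cup\{j\})\big)$. The covering coefficient $\alpha_G$ is the smallest $\alpha>0$ for which there exist a minimum-entropy cover $(X_j)$ and integers $Z_r^j$ with the properties listed in the claim.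
   Formalization: The parameter α ranges over the positive rationals. -}

module Defs where

open import Data.Nat as ℕ using (ℕ; zero; suc; _+_; _*_; _∸_; _^_; _≤_; _<_)
open import Data.Bool using (if_then_else_)
open import Data.Fin using (Fin; zero; suc; toℕ)
open import Data.Fin.Subset using (Subset; ⊤; ⊥; ⁅_⁆; _∪_; _∩_; _⊆_; _∉_)
open import Data.List using (List; []; _∷_; length; take; lookup)
open import Data.Vec as Vec using ()
open import Data.Integer using (+_)
open import Data.Rational using (ℚ; _/_)
open import Data.Product using (_×_)
open import Relation.Binary.PropositionalEquality using (_≡_)

∑ : ∀ {n} → (Fin n → ℕ) → ℕ
∑ {zero}  g = 0
∑ {suc n} g = g zero + ∑ (λ i → g (suc i))

∏ : ∀ {n} → (Fin n → ℕ) → ℕ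
∏ {zero}  g = 1
∏ {suc n} g = g zero * ∏ (λ i → g (suc i))

ℕ→ℚ : ℕ → ℚ
ℕ→ℚ k = (+ k) / 1

record Polymatroid {m : ℕ} (f : Subset m → ℕ) : Set where
  field
    empty      : f ⊥ ≡ 0
    monotone   : ∀ S T → S ⊆ T → f S ≤ f T
    submodular : ∀ S T → f (S ∪ T) + f (S ∩ T) ≤ f S + f T

modular : ∀ {m} → (Fin m → ℕ) → Subset m → ℕ
modular X S = ∑ (λ j → if Vec.lookup S j then X j else 0)

IsCover : ∀ {m} → (Subset m → ℕ) → (Fin m → ℕ) → Set
IsCover f X = (modular X ⊤ ≡ f ⊤) × (∀ S → modular X S ≤ f S)

-- Entropy comparison without reals: with n = f(U) fixed and Σ X_j = n,
--   Ent(X) = log₂ n − (1/n) Σ_j X_j log₂ X_j,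
-- so Ent(X) ≤ Ent(Y)  iff  ∏_j Y_j^{Y_j} ≤ ∏_j X_j^{X_j}   (with 0^0 = 1, i.e. 0 log 0 = 0).
entWeight : ∀ {m} → (Fin m → ℕ) → ℕ
entWeight X = ∏ (λ j → X j ^ X j)

MinEntropyCover : ∀ {m} → (Subset m → ℕ) → (Fin m → ℕ) → Set
MinEntropyCover f X = IsCover f X × (∀ Y → IsCover f Y → entWeight Y ≤ entWeight X)

setOf : ∀ {m} → List (Fin m) → Subset m
setOf []       = ⊥
setOf (x ∷ xs) = ⁅ x ⁆ ∪ setOf xs

W : ∀ {m} → List (Fin m) → ℕ → Subset m
W is r = setOf (take r is)

gain : ∀ {m} → (Subset m → ℕ) → Subset m → Fin m → ℕ
gain f S i = f (S ∪ ⁅ i ⁆) ∸ f S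

-- is = [i_1, …, i_l] is a run of the greedy algorithm on (U, f).
-- Step k (0-based; k = r − 1) picks i_{k+1} from S = W_k.
record GreedyRun {m : ℕ} (f : Subset m → ℕ) (is : List (Fin m)) : Set where
  field
    notDone  : ∀ (k : Fin (length is)) → f (W is (toℕ k)) < f ⊤
    fresh    : ∀ (k : Fin (length is)) → lookup is k ∉ W is (toℕ k)
    maximal  : ∀ (k : Fin (length is)) (j : Fin m) → j ∉ W is (toℕ k) →
               gain f (W is (toℕ k)) j ≤ gain f (W is (toℕ k)) (lookup is k)
    finished : f (W is (length is)) ≡ f ⊤

Δ : ∀ {m} → (Subset m → ℕ) → (is : List (Fin m)) → Fin (length is) → ℕ
Δ f is k = f (W is (suc (toℕ k))) ∸ f (W is (toℕ k))

-- a_r^j = f(W_r) − f(W_{r−1}) − (f(W_r ∪ {j}) − f(W_{r−1} ∪ {j})), for r = k + 1.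
-- (Nonnegative by submodularity, so truncated subtraction is exact.)
a : ∀ {m} → (Subset m → ℕ) → (is : List (Fin m)) → Fin (length is) → Fin m → ℕ
a f is k j = Δ f is k ∸ (f (W is (suc (toℕ k)) ∪ ⁅ j ⁆) ∸ f (W is (toℕ k) ∪ ⁅ j ⁆))

{-# OPTIONS --safe #-}
-- Both the cover and the greedy increments split n = f(U): the Z_r^j sum to Σ_j X_j = n, while the
-- Δ_r telescope to f(W_l) − f(∅) = n.  If α < 1, every row sum Σ_j Z_r^j ≤ α Δ_r is at most Δ_r,
-- and strictly smaller whenever Δ_r > 0; since n ≥ 1 some Δ_r is positive, so summing over r
-- gives n < n.
module Submission where

open import Defs
import Data.Nat.Properties as ℕ
open import Algebra.Properties.CommutativeMonoid.Sum ℕ.+-0-commutativeMonoid using (∑-comm)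
open import Algebra.Properties.Monoid.Sum ℕ.+-0-monoid using (sum; sum-cong-≗)
open import Data.Empty using (⊥-elim)
open import Data.Fin using (Fin; zero; suc; toℕ)
open import Data.Fin.Subset using (Subset; ⊤; ⁅_⁆; _∪_; _⊆_)
open import Data.Fin.Subset.Properties using (x∈p∪q⁻; x∈p∪q⁺; ⊆-min; ⊆-refl)
import Data.Integer as ℤ
import Data.Integer.Properties as ℤ
open import Data.List using (List; []; _∷_; length)
open import Data.Nat using (ℕ; zero; suc; _+_; _∸_; _≤_; _<_; NonZero; >-nonZero; z<s)
open import Data.Nat.Coprimality using (1-coprimeTo)
import Data.Nat.Coprimality as Coprime
open import Data.Product using (∃-syntax; _,_)
open import Data.Rational using (ℚ; mkℚ; 0ℚ; 1ℚ; _*_; NonNegative; Positive)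
  renaming (_≤_ to _≤ℚ_; _<_ to _<ℚ_)
import Data.Rational.Properties as ℚ
import Data.Sum as Sum
open import Function using (_∘_)
open import Relation.Nullary using (yes; no)
open import Relation.Binary.PropositionalEquality
  using (_≡_; refl; sym; cong; cong₂; subst; subst₂; module ≡-Reasoning)

open ≡-Reasoning

ℕ→ℚ-mkℚ : ∀ n → ℕ→ℚ n ≡ mkℚ (ℤ.+ n) 0 (Coprime.sym (1-coprimeTo n))
ℕ→ℚ-mkℚ n = ℚ.normalize-coprime (Coprime.sym (1-coprimeTo n))

ℕ→ℚ-nonNegative : ∀ n → NonNegative (ℕ→ℚ n)
ℕ→ℚ-nonNegative n rewrite ℕ→ℚ-mkℚ n = _

ℕ→ℚ-positive : ∀ n .{{_ : NonZero n}} → Positive (ℕ→ℚ n)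
ℕ→ℚ-positive (suc n) rewrite ℕ→ℚ-mkℚ (suc n) = _

ℕ→ℚ-cancel-≤ : ∀ {m n} → ℕ→ℚ m ≤ℚ ℕ→ℚ n → m ≤ n
ℕ→ℚ-cancel-≤ {m} {n} p rewrite ℕ→ℚ-mkℚ m | ℕ→ℚ-mkℚ n =
  ℤ.drop‿+≤+ (subst₂ ℤ._≤_ (ℤ.*-identityʳ (ℤ.+ m)) (ℤ.*-identityʳ (ℤ.+ n)) (ℚ.drop-*≤* p))

ℕ→ℚ-cancel-< : ∀ {m n} → ℕ→ℚ m <ℚ ℕ→ℚ n → m < n
ℕ→ℚ-cancel-< {m} {n} p rewrite ℕ→ℚ-mkℚ m | ℕ→ℚ-mkℚ n =
  ℤ.drop‿+<+ (subst₂ ℤ._<_ (ℤ.*-identityʳ (ℤ.+ m)) (ℤ.*-identityʳ (ℤ.+ n)) (ℚ.drop-*<* p))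

≤-*-≤1 : ∀ {α p} q .{{_ : NonNegative q}} → α ≤ℚ 1ℚ → p ≤ℚ α * q → p ≤ℚ q
≤-*-≤1 {α} q α≤1 p≤αq =
  ℚ.≤-trans p≤αq (subst (α * q ≤ℚ_) (ℚ.*-identityˡ q) (ℚ.*-monoʳ-≤-nonNeg q α≤1))

≤-*-<1 : ∀ {α p} q .{{_ : Positive q}} → α <ℚ 1ℚ → p ≤ℚ α * q → p <ℚ q
≤-*-<1 {α} q α<1 p≤αq =
  ℚ.≤-<-trans p≤αq (subst (α * q <ℚ_) (ℚ.*-identityˡ q) (ℚ.*-monoˡ-<-pos q α<1))

ℕ→ℚ-≤-*-≤1 : ∀ {α m n} → α ≤ℚ 1ℚ → ℕ→ℚ m ≤ℚ α * ℕ→ℚ n → m ≤ n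
ℕ→ℚ-≤-*-≤1 {n = n} α≤1 =
  ℕ→ℚ-cancel-≤ ∘ ≤-*-≤1 (ℕ→ℚ n) {{ℕ→ℚ-nonNegative n}} α≤1

ℕ→ℚ-≤-*-<1 : ∀ {α m n} .{{_ : NonZero n}} → α <ℚ 1ℚ → ℕ→ℚ m ≤ℚ α * ℕ→ℚ n → m < n
ℕ→ℚ-≤-*-<1 {n = n} α<1 =
  ℕ→ℚ-cancel-< ∘ ≤-*-<1 (ℕ→ℚ n) {{ℕ→ℚ-positive n}} α<1

∑≡sum : ∀ {n} (g : Fin n → ℕ) → ∑ g ≡ sum g
∑≡sum {zero}  g = refl
∑≡sum {suc n} g = cong (g zero +_) (∑≡sum (g ∘ suc))

∑-swap : ∀ {m n} (g : Fin m → Fin n → ℕ) → ∑ (λ i → ∑ (g i)) ≡ ∑ (λ j → ∑ (λ i → g i j))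
∑-swap g = begin
  ∑ (λ i → ∑ (g i))                      ≡⟨ ∑≡sum (λ i → ∑ (g i)) ⟩
  sum (λ i → ∑ (g i))                    ≡⟨ sum-cong-≗ (λ i → ∑≡sum (g i)) ⟩
  sum (λ i → sum (g i))                  ≡⟨ ∑-comm g ⟩
  sum (λ j → sum (λ i → g i j))          ≡⟨ sum-cong-≗ (λ j → ∑≡sum (λ i → g i j)) ⟨
  sum (λ j → ∑ (λ i → g i j))            ≡⟨ ∑≡sum (λ j → ∑ (λ i → g i j)) ⟨
  ∑ (λ j → ∑ (λ i → g i j))              ∎

∑-cong : ∀ {n} {g h : Fin n → ℕ} → (∀ i → g i ≡ h i) → ∑ g ≡ ∑ h
∑-cong {zero}  g≗h = refl
∑-cong {suc n} g≗h = cong₂ _+_ (g≗h zero) (∑-cong (g≗h ∘ suc))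

∑-mono-≤ : ∀ {n} {g h : Fin n → ℕ} → (∀ i → g i ≤ h i) → ∑ g ≤ ∑ h
∑-mono-≤ {zero}  g≤h = ℕ.≤-refl
∑-mono-≤ {suc n} g≤h = ℕ.+-mono-≤ (g≤h zero) (∑-mono-≤ (g≤h ∘ suc))

∑-mono-< : ∀ {n} {g h : Fin n → ℕ} → (∀ i → g i ≤ h i) → ∀ i → g i < h i → ∑ g < ∑ h
∑-mono-< {suc n} g≤h zero    gi<hi = ℕ.+-mono-<-≤ gi<hi (∑-mono-≤ (g≤h ∘ suc))
∑-mono-< {suc n} g≤h (suc i) gi<hi = ℕ.+-mono-≤-< (g≤h zero) (∑-mono-< (g≤h ∘ suc) i gi<hi)

∑-positive : ∀ {n} (g : Fin n → ℕ) → 0 < ∑ g → ∃[ i ] 0 < g i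
∑-positive {suc n} g 0<∑g with g zero in eq
... | suc _ = zero , subst (0 <_) (sym eq) z<s
... | zero  = let i , 0<gi = ∑-positive (g ∘ suc) 0<∑g in suc i , 0<gi

∑-scaled-<1 : ∀ {n α} {g h : Fin n → ℕ} → α <ℚ 1ℚ →
              (∀ i → ℕ→ℚ (g i) ≤ℚ α * ℕ→ℚ (h i)) → 0 < ∑ h → ∑ g < ∑ h
∑-scaled-<1 {h = h} α<1 g≤αh 0<∑h with ∑-positive h 0<∑h
... | i , 0<hi = ∑-mono-< (λ j → ℕ→ℚ-≤-*-≤1 (ℚ.<⇒≤ α<1) (g≤αh j)) i
                          (ℕ→ℚ-≤-*-<1 {{>-nonZero 0<hi}} α<1 (g≤αh i))

∑-telescope : ∀ n (F : ℕ → ℕ) → (∀ r → F r ≤ F (suc r)) →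
              ∑ {n} (λ k → F (suc (toℕ k)) ∸ F (toℕ k)) + F 0 ≡ F n
∑-telescope zero    F F-mono = refl
∑-telescope (suc n) F F-mono = begin
  (F 1 ∸ F 0) + rest + F 0   ≡⟨ ℕ.+-assoc (F 1 ∸ F 0) rest (F 0) ⟩
  (F 1 ∸ F 0) + (rest + F 0) ≡⟨ cong ((F 1 ∸ F 0) +_) (ℕ.+-comm rest (F 0)) ⟩
  (F 1 ∸ F 0) + (F 0 + rest) ≡⟨ ℕ.+-assoc (F 1 ∸ F 0) (F 0) rest ⟨
  (F 1 ∸ F 0) + F 0 + rest   ≡⟨ cong (_+ rest) (ℕ.m∸n+n≡m (F-mono 0)) ⟩
  F 1 + rest                 ≡⟨ ℕ.+-comm (F 1) rest ⟩
  rest + F 1                 ≡⟨ ∑-telescope n (F ∘ suc) (F-mono ∘ suc) ⟩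
  F (suc n)                  ∎
  where rest = ∑ {n} (λ k → F (suc (suc (toℕ k))) ∸ F (suc (toℕ k)))

∪-monoʳ-⊆ : ∀ {m} (p : Subset m) {q r : Subset m} → q ⊆ r → p ∪ q ⊆ p ∪ r
∪-monoʳ-⊆ p q⊆r = x∈p∪q⁺ ∘ Sum.map₂ q⊆r ∘ x∈p∪q⁻ p _

W-⊆-suc : ∀ {m} (is : List (Fin m)) r → W is r ⊆ W is (suc r)
W-⊆-suc _        zero    = ⊆-min _
W-⊆-suc []       (suc r) = ⊆-refl
W-⊆-suc (i ∷ is) (suc r) = ∪-monoʳ-⊆ ⁅ i ⁆ (W-⊆-suc is r)

∑Δ≡f⊤ : ∀ {m} {f : Subset m → ℕ} {is} → Polymatroid f → GreedyRun f is → ∑ (Δ f is) ≡ f ⊤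
∑Δ≡f⊤ {f = f} {is} pm run = begin
  ∑ (Δ f is)               ≡⟨ ℕ.+-identityʳ _ ⟨
  ∑ (Δ f is) + 0           ≡⟨ cong (∑ (Δ f is) +_) empty ⟨
  ∑ (Δ f is) + f (W is 0)  ≡⟨ ∑-telescope (length is) (f ∘ W is) f∘W-mono ⟩
  f (W is (length is))     ≡⟨ finished ⟩
  f ⊤                      ∎
  where
  open Polymatroid pm
  open GreedyRun run
  f∘W-mono : ∀ r → f (W is r) ≤ f (W is (suc r))
  f∘W-mono r = monotone _ _ (W-⊆-suc is r)

modular-⊤ : ∀ {m} (X : Fin m → ℕ) → modular X ⊤ ≡ ∑ X
modular-⊤ {zero}  X = refl
modular-⊤ {suc m} X = cong (X zero +_) (modular-⊤ (X ∘ suc))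

proposition3 : (m : ℕ) (f : Subset m → ℕ) → Polymatroid f → 1 ≤ f ⊤ →
    (is : List (Fin m)) → GreedyRun f is →
    (α : ℚ) → 0ℚ <ℚ α →
    (X : Fin m → ℕ) → MinEntropyCover f X →
    (Z : Fin (length is) → Fin m → ℕ) →
    (∀ k j → Z k j ≤ a f is k j) →
    (∀ j → ∑ (λ k → Z k j) ≡ X j) →
    (∀ k → ℕ→ℚ (∑ (Z k)) ≤ℚ α * ℕ→ℚ (Δ f is k)) →
    1ℚ ≤ℚ α
proposition3 m f pm 1≤n is run α _ X ((∑X≡n , _) , _) Z _ ∑Z≡X ∑Z≤αΔ with 1ℚ ℚ.≤? α
... | yes 1≤α = 1≤α
... | no  1≰α = ⊥-elim (ℕ.<-irrefl ∑Z≡∑Δ ∑Z<∑Δ)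
  where
  ∑Z≡∑Δ : ∑ (λ k → ∑ (Z k)) ≡ ∑ (Δ f is)
  ∑Z≡∑Δ = begin
    ∑ (λ k → ∑ (Z k))          ≡⟨ ∑-swap Z ⟩
    ∑ (λ j → ∑ (λ k → Z k j))  ≡⟨ ∑-cong ∑Z≡X ⟩
    ∑ X                        ≡⟨ modular-⊤ X ⟨
    modular X ⊤                ≡⟨ ∑X≡n ⟩
    f ⊤                        ≡⟨ ∑Δ≡f⊤ pm run ⟨
    ∑ (Δ f is)                 ∎
  ∑Z<∑Δ : ∑ (λ k → ∑ (Z k)) < ∑ (Δ f is)
  ∑Z<∑Δ = ∑-scaled-<1 (ℚ.≰⇒> 1≰α) ∑Z≤αΔ (subst (0 <_) (sym (∑Δ≡f⊤ pm run)) 1≤n)
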